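{- Let $\lambda$ be a partition with $l=l(\lambda)$ parts, and let $i,k,p,q$ be positive integers with $k\le l(\lambda)$. Let $\lambda-p\epsilon_k=(\lambda_1,\ldots,\lambda_{k-1},\lambda_k-p,\lambda_{k+1},\ldots,\lambda_l)\in\mathbb{Z}^l$. Then \[c^{\lambda-p\epsilon_k}_i(q)=c^\lambda_i(q)+pq\sum_{\substack{r,s,t\ge 0\\ r+s+t+2=i}}c^\lambda_t(q)\,(\lambda_k-k+q+1)^r\,(\lambda_k-k-p+1)^s.\]
   Context: For a finite integer sequence $\nu=(\nu_1,\ldots,\nu_l)\in\mathbb{Z}^l$ (not necessarily decreasing) and an indeterminate $x$, the quantities $c^\nu_m(x)$, $m\ge 0$, are defined by the expansion in descending powers of $y$ \[\prod_{i=1}^{l}\frac{(x-y+1+\nu_i-i)(-y+1-i)}{(x-y+1-i)(-y+1+\nu_i-i)}=-x\sum_{m\ge 0}c^\nu_m(x)\,y^{ -m}.\] (The coefficients are shifted symmetric polynomials in $\nu$; for a partition the left side equals $\frac{C_\nu(x-y+1)}{C_\nu(x-y)}\frac{C_\nu(-y)}{C_\nu(-y+1)}$ with $C_\nu(z)=\prod_{(i,j)\in\nu}(z+j-i)$ the content polynomial.) In particular $c^\lambda_0(q)=-1/q$. -}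

module Defs where

open import Data.Nat as ℕ using (ℕ; zero; suc; _∸_; NonZero)
open import Data.Integer as ℤ using (ℤ; +_)
open import Data.Rational as ℚ using (ℚ; _+_; _*_; _-_; -_; 0ℚ; 1ℚ; _/_)
open import Data.Fin using (Fin; toℕ)
open import Data.Vec using (Vec; []; _∷_; lookup; updateAt; map)

ℤtoℚ : ℤ → ℚ
ℤtoℚ z = z / 1

ℕtoℚ : ℕ → ℚ
ℕtoℚ n = ℤtoℚ (+ n)

_^ℚ_ : ℚ → ℕ → ℚ
a ^ℚ zero = 1ℚ
a ^ℚ suc n = a * (a ^ℚ n)

Σ≤ : ℕ → (ℕ → ℚ) → ℚ
Σ≤ zero f = f 0
Σ≤ (suc n) f = Σ≤ n f + f (suc n)

-- formal power series in u = y⁻¹ with rational coefficients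
Series : Set
Series = ℕ → ℚ

oneS : Series
oneS zero = 1ℚ
oneS (suc n) = 0ℚ

_⊛_ : Series → Series → Series
(f ⊛ g) n = Σ≤ n (λ j → f j * g (n ∸ j))

-- expansion of (a - y)/(b - y) = (1 - a u)/(1 - b u) in powers of u = y⁻¹
ratioS : ℚ → ℚ → Series
ratioS a b zero = 1ℚ
ratioS a b (suc n) = (b ^ℚ suc n) - a * (b ^ℚ n)

-- the i-th factor (i ≥ 1) of the product, for part νᵢ and parameter x:
--   (x - y + 1 + νᵢ - i)/(x - y + 1 - i) · (-y + 1 - i)/(-y + 1 + νᵢ - i)
factorS : ℚ → ℕ → ℤ → Series
factorS x i νi =
  ratioS (x + 1ℚ + ℤtoℚ νi - ℕtoℚ i) (x + 1ℚ - ℕtoℚ i)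
  ⊛ ratioS (1ℚ - ℕtoℚ i) (1ℚ + ℤtoℚ νi - ℕtoℚ i)

prodFrom : ∀ {l} → ℚ → ℕ → Vec ℤ l → Series
prodFrom x i [] = oneS
prodFrom x i (νi ∷ ν) = factorS x i νi ⊛ prodFrom x (suc i) ν

prodS : ∀ {l} → ℚ → Vec ℤ l → Series
prodS x ν = prodFrom x 1 ν

-- c^ν_m(q) for a positive integer q:  ∏ = -q Σ_m c^ν_m(q) y^{-m}
c : ∀ {l} → Vec ℤ l → (q : ℕ) → .{{_ : NonZero q}} → ℕ → ℚ
c ν q m = - (prodS (ℕtoℚ q) ν m * ((+ 1) / q))

IsPartition : ∀ {l} → Vec ℕ l → Set
IsPartition {l} λ′ =
  (∀ (j : Fin l) → 1 ℕ.≤ lookup λ′ j) ×′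
  (∀ (j j′ : Fin l) → toℕ j ℕ.≤ toℕ j′ → lookup λ′ j′ ℕ.≤ lookup λ′ j)
  where
  open import Data.Product using () renaming (_×_ to _×′_)

-- Σ_{r,s,t ≥ 0, r+s+t+2 = i} f r s t
tripleSum : ℕ → (ℕ → ℕ → ℕ → ℚ) → ℚ
tripleSum zero f = 0ℚ
tripleSum (suc zero) f = 0ℚ
tripleSum (suc (suc n)) f =
  Σ≤ n (λ t → Σ≤ (n ∸ t) (λ r → f r (n ∸ t ∸ r) t))

toℤs : ∀ {l} → Vec ℕ l → Vec ℤ l
toℤs = map (λ n → ℤ.+ n)

-- λ - p εₖ  (k given as a Fin l, i.e. 0-based)
minusAt : ∀ {l} → Vec ℕ l → Fin l → ℕ → Vec ℤ l
minusAt λ′ k p = updateAt (toℤs λ′) k (λ z → z ℤ.- ℤ.+ p)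

-- Write u = y⁻¹ and work with formal power series in u (functions ℕ → ℚ).  The k-th factor of
-- the product, for a part v, is (1 - A_v u)(1 - d u) / ((1 - c u)(1 - B_v u))
-- with A_v = x + 1 + v - k, B_v = 1 + v - k.  Writing α = A_v, β = B_{v-p},
-- γ = A_{v-p}, δ = B_v, cross-multiplying gives
--     (1 - α u)(1 - β u) P' = (1 - γ u)(1 - δ u) P                 (†)
-- for the products P, P' of ν and ν - p εₖ, and since α + β = γ + δ and
-- αβ + p x = γδ we have (1 - γ u)(1 - δ u) = (1 - α u)(1 - β u) + p x u².
-- Cancelling (1 - α u)(1 - β u) yields
--     P' = P + p x u² · P / ((1 - α u)(1 - β u)),
-- and 1 / ((1 - α u)(1 - β u)) = Σ_m (Σ_{r+s=m} α^r β^s) u^m.  Reading off the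
-- i-th coefficient (with c = -P/q) is exactly the claimed triple sum.
module Submission where

open import Defs
open import Data.Nat using (ℕ; zero; suc; _≤_; _∸_; NonZero)
import Data.Nat as ℕ
import Data.Nat.Properties as ℕP
open import Data.Fin using (Fin; toℕ)
import Data.Fin as F
open import Data.Vec using (Vec; lookup; _∷_; updateAt)
open import Data.Vec.Properties using (lookup-map)
open import Data.Integer as ℤ using (ℤ)
import Data.Integer.Solver as ℤSolver
open import Data.Rational using (ℚ; _+_; _*_; _-_; -_; 0ℚ; 1ℚ; _/_)
import Data.Rational.Properties as ℚP
import Data.Rational.Unnormalised as U
import Data.Rational.Unnormalised.Properties as UP
open import Data.Rational.Solver using (module +-*-Solver)
open +-*-Solver
open import Relation.Binary.PropositionalEquality

Σ-cong : ∀ n {f g : ℕ → ℚ} → (∀ j → j ≤ n → f j ≡ g j) → Σ≤ n f ≡ Σ≤ n g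
Σ-cong zero    e = e 0 ℕ.z≤n
Σ-cong (suc n) e =
  cong₂ _+_ (Σ-cong n (λ j j≤n → e j (ℕP.m≤n⇒m≤1+n j≤n))) (e (suc n) ℕP.≤-refl)

Σ-front : ∀ n (f : ℕ → ℚ) → Σ≤ (suc n) f ≡ f 0 + Σ≤ n (λ j → f (suc j))
Σ-front zero    f = refl
Σ-front (suc n) f = trans (cong (_+ f (suc (suc n))) (Σ-front n f))
  (solve 3 (λ a b c → (a :+ b) :+ c := a :+ (b :+ c)) refl
    (f 0) (Σ≤ n (λ j → f (suc j))) (f (suc (suc n))))

Σ-scale : ∀ n k (f : ℕ → ℚ) → Σ≤ n (λ j → k * f j) ≡ k * Σ≤ n f
Σ-scale zero    k f = refl
Σ-scale (suc n) k f = trans (cong (_+ k * f (suc n)) (Σ-scale n k f))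
  (solve 3 (λ s a k → k :* s :+ k :* a := k :* (s :+ a)) refl (Σ≤ n f) (f (suc n)) k)

Σ-lin : ∀ n (f g : ℕ → ℚ) k → Σ≤ n (λ j → f j - k * g j) ≡ Σ≤ n f - k * Σ≤ n g
Σ-lin zero    f g k = refl
Σ-lin (suc n) f g k = trans (cong (_+ (f (suc n) - k * g (suc n))) (Σ-lin n f g k))
  (solve 5 (λ s₁ s₂ a b k → (s₁ :- k :* s₂) :+ (a :- k :* b) := (s₁ :+ a) :- k :* (s₂ :+ b))
    refl (Σ≤ n f) (Σ≤ n g) (f (suc n)) (g (suc n)) k)

Σ-zero : ∀ n → Σ≤ n (λ _ → 0ℚ) ≡ 0ℚ
Σ-zero zero    = refl
Σ-zero (suc n) = cong (_+ 0ℚ) (Σ-zero n)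

suc-∸ : ∀ {n j} → j ≤ n → suc n ∸ j ≡ suc (n ∸ j)
suc-∸ j≤n = ℕP.+-∸-assoc 1 j≤n

infix 4 _≈S_
_≈S_ : Series → Series → Set
f ≈S g = ∀ n → f n ≡ g n

≈-refl : ∀ {f} → f ≈S f
≈-refl n = refl

≈-sym : ∀ {f g} → f ≈S g → g ≈S f
≈-sym e n = sym (e n)

≈-trans : ∀ {f g h} → f ≈S g → g ≈S h → f ≈S h
≈-trans e₁ e₂ n = trans (e₁ n) (e₂ n)

⊛-cong : ∀ {f f′ g g′} → f ≈S f′ → g ≈S g′ → (f ⊛ g) ≈S (f′ ⊛ g′)
⊛-cong e₁ e₂ n = Σ-cong n (λ j _ → cong₂ _*_ (e₁ j) (e₂ (n ∸ j)))

⊛-congˡ : ∀ {f f′} g → f ≈S f′ → (f ⊛ g) ≈S (f′ ⊛ g)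
⊛-congˡ g e = ⊛-cong e (≈-refl {g})

⊛-congʳ : ∀ f {g g′} → g ≈S g′ → (f ⊛ g) ≈S (f ⊛ g′)
⊛-congʳ f e = ⊛-cong (≈-refl {f}) e

⊛-scaleˡ : ∀ k f g → ((λ n → k * f n) ⊛ g) ≈S (λ n → k * (f ⊛ g) n)
⊛-scaleˡ k f g n =
  trans (Σ-cong n (λ j _ → solve 3 (λ k a b → (k :* a) :* b := k :* (a :* b)) refl
                             k (f j) (g (n ∸ j))))
        (Σ-scale n k (λ j → f j * g (n ∸ j)))

⊛-oneS : ∀ f → (f ⊛ oneS) ≈S f
⊛-oneS f zero = solve 1 (λ a → a :* con 1ℚ := a) refl (f 0)
⊛-oneS f (suc n) rewrite ℕP.n∸n≡0 n =
  trans (cong (_+ f (suc n) * 1ℚ) (trans (Σ-cong n vanish) (Σ-zero n)))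
        (solve 1 (λ a → con 0ℚ :+ a :* con 1ℚ := a) refl (f (suc n)))
  where
  vanish : ∀ j → j ≤ n → f j * oneS (suc n ∸ j) ≡ 0ℚ
  vanish j j≤n rewrite suc-∸ j≤n = solve 1 (λ a → a :* con 0ℚ := con 0ℚ) refl (f j)

shift2 : Series → Series
shift2 f zero          = 0ℚ
shift2 f (suc zero)    = 0ℚ
shift2 f (suc (suc n)) = f n

shift2-cong : ∀ {f g} → f ≈S g → shift2 f ≈S shift2 g
shift2-cong e zero          = refl
shift2-cong e (suc zero)    = refl
shift2-cong e (suc (suc n)) = e n

shift2-scale : ∀ k f n → k * shift2 f n ≡ shift2 (λ m → k * f m) n
shift2-scale k f zero          = solve 1 (λ k → k :* con 0ℚ := con 0ℚ) refl k
shift2-scale k f (suc zero)    = solve 1 (λ k → k :* con 0ℚ := con 0ℚ) refl k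
shift2-scale k f (suc (suc n)) = refl

-- mulLin a f = (1 - a u) f, computed coefficientwise.
mulLin : ℚ → Series → Series
mulLin a f zero    = f zero
mulLin a f (suc n) = f (suc n) - a * f n

mulLin-cong : ∀ a {f g} → f ≈S g → mulLin a f ≈S mulLin a g
mulLin-cong a e zero    = e 0
mulLin-cong a e (suc n) = cong₂ (λ s t → s - a * t) (e (suc n)) (e n)

mulLin-⊛ˡ : ∀ a f g → mulLin a (f ⊛ g) ≈S (mulLin a f ⊛ g)
mulLin-⊛ˡ a f g zero    = refl
mulLin-⊛ˡ a f g (suc n) = begin
    Σ≤ (suc n) (λ j → f j * g (suc n ∸ j)) - a * Σ≤ n fg
  ≡⟨ cong (_- a * Σ≤ n fg) (Σ-front n (λ j → f j * g (suc n ∸ j))) ⟩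
    (f 0 * g (suc n) + Σ≤ n f′g) - a * Σ≤ n fg
  ≡⟨ solve 4 (λ h s₁ a s₀ → (h :+ s₁) :- a :* s₀ := h :+ (s₁ :- a :* s₀)) refl
       (f 0 * g (suc n)) (Σ≤ n f′g) a (Σ≤ n fg) ⟩
    f 0 * g (suc n) + (Σ≤ n f′g - a * Σ≤ n fg)
  ≡⟨ cong (f 0 * g (suc n) +_) (sym (Σ-lin n f′g fg a)) ⟩
    f 0 * g (suc n) + Σ≤ n (λ j → f′g j - a * fg j)
  ≡⟨ cong (f 0 * g (suc n) +_) (Σ-cong n (λ j _ →
       solve 4 (λ s t w a → s :* w :- a :* (t :* w) := (s :- a :* t) :* w) refl
         (f (suc j)) (f j) (g (n ∸ j)) a)) ⟩
    f 0 * g (suc n) + Σ≤ n (λ j → mulLin a f (suc j) * g (n ∸ j))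
  ≡⟨ sym (Σ-front n (λ j → mulLin a f j * g (suc n ∸ j))) ⟩
    (mulLin a f ⊛ g) (suc n)
  ∎
  where
  open ≡-Reasoning
  fg f′g : ℕ → ℚ
  fg  j = f j * g (n ∸ j)
  f′g j = f (suc j) * g (n ∸ j)

mulLin-⊛ʳ : ∀ a f g → mulLin a (f ⊛ g) ≈S (f ⊛ mulLin a g)
mulLin-⊛ʳ a f g zero    = refl
mulLin-⊛ʳ a f g (suc n) rewrite ℕP.n∸n≡0 n = begin
    (Σ≤ n fg′ + f (suc n) * g 0) - a * Σ≤ n fg
  ≡⟨ solve 4 (λ s₁ h a s₀ → (s₁ :+ h) :- a :* s₀ := (s₁ :- a :* s₀) :+ h) refl
       (Σ≤ n fg′) (f (suc n) * g 0) a (Σ≤ n fg) ⟩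
    (Σ≤ n fg′ - a * Σ≤ n fg) + f (suc n) * g 0
  ≡⟨ cong (_+ f (suc n) * g 0) (sym (Σ-lin n fg′ fg a)) ⟩
    Σ≤ n (λ j → fg′ j - a * fg j) + f (suc n) * g 0
  ≡⟨ cong (_+ f (suc n) * g 0) (Σ-cong n termwise) ⟩
    Σ≤ n (λ j → f j * mulLin a g (suc n ∸ j)) + f (suc n) * g 0
  ∎
  where
  open ≡-Reasoning
  fg fg′ : ℕ → ℚ
  fg  j = f j * g (n ∸ j)
  fg′ j = f j * g (suc n ∸ j)
  termwise : ∀ j → j ≤ n → fg′ j - a * fg j ≡ f j * mulLin a g (suc n ∸ j)
  termwise j j≤n rewrite suc-∸ j≤n =
    solve 4 (λ s w t a → s :* w :- a :* (s :* t) := s :* (w :- a :* t)) refl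
      (f j) (g (suc (n ∸ j))) (g (n ∸ j)) a

mulLin-inj : ∀ a {f g} → mulLin a f ≈S mulLin a g → f ≈S g
mulLin-inj a e zero = e 0
mulLin-inj a {f} {g} e (suc n) = begin
    f (suc n)
  ≡⟨ solve 3 (λ s t a → s := (s :- a :* t) :+ a :* t) refl (f (suc n)) (f n) a ⟩
    (f (suc n) - a * f n) + a * f n
  ≡⟨ cong₂ (λ s t → s + a * t) (e (suc n)) (mulLin-inj a e n) ⟩
    (g (suc n) - a * g n) + a * g n
  ≡⟨ solve 3 (λ s t a → (s :- a :* t) :+ a :* t := s) refl (g (suc n)) (g n) a ⟩
    g (suc n)
  ∎ where open ≡-Reasoning

mulLin-linear : ∀ b K f h →
  mulLin b (λ n → f n + K * h n) ≈S (λ n → mulLin b f n + K * mulLin b h n)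
mulLin-linear b K f h zero    = refl
mulLin-linear b K f h (suc n) =
  solve 6 (λ b K s t w z → (s :+ K :* w) :- b :* (t :+ K :* z)
                          := (s :- b :* t) :+ K :* (w :- b :* z))
    refl b K (f (suc n)) (f n) (h (suc n)) (h n)

mulLin-shift2 : ∀ b f → mulLin b (shift2 f) ≈S shift2 (mulLin b f)
mulLin-shift2 b f zero                = refl
mulLin-shift2 b f (suc zero)          = solve 1 (λ b → con 0ℚ :- b :* con 0ℚ := con 0ℚ) refl b
mulLin-shift2 b f (suc (suc zero))    = solve 2 (λ b s → s :- b :* con 0ℚ := s) refl b (f 0)
mulLin-shift2 b f (suc (suc (suc n))) = refl

mulQuad : ℚ → ℚ → Series → Series
mulQuad α β f = mulLin α (mulLin β f)

mulQuad-⊛ˡ : ∀ α β f g → mulQuad α β (f ⊛ g) ≈S (mulQuad α β f ⊛ g)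
mulQuad-⊛ˡ α β f g =
  ≈-trans (mulLin-cong α (mulLin-⊛ˡ β f g)) (mulLin-⊛ˡ α (mulLin β f) g)

mulQuad-⊛ʳ : ∀ α β f g → mulQuad α β (f ⊛ g) ≈S (f ⊛ mulQuad α β g)
mulQuad-⊛ʳ α β f g =
  ≈-trans (mulLin-cong α (mulLin-⊛ʳ β f g)) (mulLin-⊛ʳ α f (mulLin β g))

mulQuad-inj : ∀ α β {f g} → mulQuad α β f ≈S mulQuad α β g → f ≈S g
mulQuad-inj α β e = mulLin-inj β (mulLin-inj α e)

mulQuad-linear : ∀ α β K f h →
  mulQuad α β (λ n → f n + K * h n) ≈S (λ n → mulQuad α β f n + K * mulQuad α β h n)
mulQuad-linear α β K f h =
  ≈-trans (mulLin-cong α (mulLin-linear β K f h))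
          (mulLin-linear α K (mulLin β f) (mulLin β h))

mulQuad-shift2 : ∀ α β f → mulQuad α β (shift2 f) ≈S shift2 (mulQuad α β f)
mulQuad-shift2 α β f =
  ≈-trans (mulLin-cong α (mulLin-shift2 β f)) (mulLin-shift2 α (mulLin β f))

mulQuad-perturb : ∀ α β γ δ K P → α + β ≡ γ + δ → α * β + K ≡ γ * δ →
  (λ n → mulQuad α β P n + K * shift2 P n) ≈S mulQuad γ δ P
mulQuad-perturb α β γ δ K P sum≡ prod≡ zero =
  solve 2 (λ p K → p :+ K :* con 0ℚ := p) refl (P 0) K
mulQuad-perturb α β γ δ K P sum≡ prod≡ (suc zero) =
  trans (solve 5 (λ p₁ p₀ a b K → ((p₁ :- b :* p₀) :- a :* p₀) :+ K :* con 0ℚ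
                                 := p₁ :- (a :+ b) :* p₀) refl (P 1) (P 0) α β K)
  (trans (cong (λ s → P 1 - s * P 0) sum≡)
    (solve 4 (λ p₁ p₀ c d → p₁ :- (c :+ d) :* p₀ := (p₁ :- d :* p₀) :- c :* p₀) refl
      (P 1) (P 0) γ δ))
mulQuad-perturb α β γ δ K P sum≡ prod≡ (suc (suc n)) =
  trans (solve 6 (λ p₂ p₁ p₀ a b K →
                    ((p₂ :- b :* p₁) :- a :* (p₁ :- b :* p₀)) :+ K :* p₀
                    := (p₂ :- (a :+ b) :* p₁) :+ (a :* b :+ K) :* p₀)
           refl (P (suc (suc n))) (P (suc n)) (P n) α β K)
  (trans (cong₂ (λ s t → (P (suc (suc n)) - s * P (suc n)) + t * P n) sum≡ prod≡)
    (solve 5 (λ p₂ p₁ p₀ c d → (p₂ :- (c :+ d) :* p₁) :+ (c :* d) :* p₀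
                              := (p₂ :- d :* p₁) :- c :* (p₁ :- d :* p₀))
       refl (P (suc (suc n))) (P (suc n)) (P n) γ δ))

linS : ℚ → Series
linS a zero          = 1ℚ
linS a (suc zero)    = - a
linS a (suc (suc n)) = 0ℚ

mulLin-ratioS : ∀ a b → mulLin b (ratioS a b) ≈S linS a
mulLin-ratioS a b zero = refl
mulLin-ratioS a b (suc zero) =
  solve 2 (λ a b → (b :* con 1ℚ :- a :* con 1ℚ) :- b :* con 1ℚ := :- a) refl a b
mulLin-ratioS a b (suc (suc n)) =
  solve 3 (λ a b c → (b :* (b :* c) :- a :* (b :* c)) :- b :* (b :* c :- a :* c) := con 0ℚ)
    refl a b (b ^ℚ n)

mulLin-ratioS-swap : ∀ α γ c → mulLin α (ratioS γ c) ≈S mulLin γ (ratioS α c)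
mulLin-ratioS-swap α γ c zero = refl
mulLin-ratioS-swap α γ c (suc zero) =
  solve 3 (λ α γ c → (c :* con 1ℚ :- γ :* con 1ℚ) :- α :* con 1ℚ
                    := (c :* con 1ℚ :- α :* con 1ℚ) :- γ :* con 1ℚ) refl α γ c
mulLin-ratioS-swap α γ c (suc (suc n)) =
  solve 4 (λ α γ c d → (c :* (c :* d) :- γ :* (c :* d)) :- α :* (c :* d :- γ :* d)
                      := (c :* (c :* d) :- α :* (c :* d)) :- γ :* (c :* d :- α :* d))
    refl α γ c (c ^ℚ n)

geom : ℚ → Series
geom α n = α ^ℚ n

mulLin-geom : ∀ α → mulLin α (geom α) ≈S oneS
mulLin-geom α zero    = refl
mulLin-geom α (suc n) = solve 2 (λ a c → a :* c :- a :* c := con 0ℚ) refl α (α ^ℚ n)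

invQuad : ℚ → ℚ → Series
invQuad α β = geom α ⊛ geom β

mulQuad-invQuad : ∀ α β → mulQuad α β (invQuad α β) ≈S oneS
mulQuad-invQuad α β =
  ≈-trans (mulLin-cong α (≈-trans (mulLin-⊛ʳ β (geom α) (geom β))
                         (≈-trans (⊛-congʳ (geom α) (mulLin-geom β)) (⊛-oneS (geom α)))))
          (mulLin-geom α)

numeratorRoot : ℚ → ℕ → ℤ → ℚ
numeratorRoot x j v = x + 1ℚ + ℤtoℚ v - ℕtoℚ j

denominatorRoot : ℕ → ℤ → ℚ
denominatorRoot j v = 1ℚ + ℤtoℚ v - ℕtoℚ j

-- Cross-multiplying the j-th factors for two parts v and v′: both sides equal
-- (1 - A_v u)(1 - A_{v′} u)(1 - (1 - j) u)/(1 - (x + 1 - j) u).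
factorS-cross : ∀ x j v v′ →
  mulQuad (numeratorRoot x j v) (denominatorRoot j v′) (factorS x j v′)
    ≈S mulQuad (numeratorRoot x j v′) (denominatorRoot j v) (factorS x j v)
factorS-cross x j v v′ =
  ≈-trans (clear α v′) (≈-trans (⊛-congˡ (linS d₀) (mulLin-ratioS-swap α γ c₀))
                                (≈-sym (clear γ v)))
  where
  α = numeratorRoot x j v
  γ = numeratorRoot x j v′
  c₀ = x + 1ℚ - ℕtoℚ j
  d₀ = 1ℚ - ℕtoℚ j
  clear : ∀ a w → mulQuad a (denominatorRoot j w) (factorS x j w)
                    ≈S (mulLin a (ratioS (numeratorRoot x j w) c₀) ⊛ linS d₀)
  clear a w = ≈-trans (mulLin-cong a (mulLin-⊛ʳ b (ratioS (numeratorRoot x j w) c₀) (ratioS d₀ b)))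
    (≈-trans (mulLin-cong a (⊛-congʳ (ratioS (numeratorRoot x j w) c₀) (mulLin-ratioS d₀ b)))
             (mulLin-⊛ˡ a (ratioS (numeratorRoot x j w) c₀) (linS d₀)))
    where b = denominatorRoot j w

-- An identity (†) for the factor at position k propagates to the product of
-- the factors with indices i, i+1, …, since mulQuad commutes with every other
-- factor of the Cauchy product.
prodFrom-update : ∀ {l} x i (ν : Vec ℤ l) (k : Fin l) (g : ℤ → ℤ) α β γ δ j →
  j ≡ toℕ k ℕ.+ i →
  mulQuad α β (factorS x j (g (lookup ν k))) ≈S mulQuad γ δ (factorS x j (lookup ν k)) →
  mulQuad α β (prodFrom x i (updateAt ν k g)) ≈S mulQuad γ δ (prodFrom x i ν)
prodFrom-update x i (v ∷ ν) F.zero g α β γ δ .i refl cross =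
  ≈-trans (mulQuad-⊛ˡ α β (factorS x i (g v)) rest)
  (≈-trans (⊛-congˡ rest cross) (≈-sym (mulQuad-⊛ˡ γ δ (factorS x i v) rest)))
  where rest = prodFrom x (suc i) ν
prodFrom-update x i (v ∷ ν) (F.suc k) g α β γ δ j j≡ cross =
  ≈-trans (mulQuad-⊛ʳ α β f (prodFrom x (suc i) (updateAt ν k g)))
  (≈-trans (⊛-congʳ f (prodFrom-update x (suc i) ν k g α β γ δ j
                         (trans j≡ (sym (ℕP.+-suc (toℕ k) i))) cross))
           (≈-sym (mulQuad-⊛ʳ γ δ f (prodFrom x (suc i) ν))))
  where f = factorS x i v

ℤtoℚ-minus : ∀ a b → ℤtoℚ (a ℤ.- b) ≡ ℤtoℚ a - ℤtoℚ b
ℤtoℚ-minus a b = ℚP.toℚᵘ-injective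
  (UP.≃-trans (ℚP.toℚᵘ-fromℚᵘ (U.mkℚᵘ (a ℤ.- b) 0))
  (UP.≃-trans difference
  (UP.≃-sym (UP.≃-trans (ℚP.toℚᵘ-homo-+ (ℤtoℚ a) (- ℤtoℚ b))
    (UP.+-cong (ℚP.toℚᵘ-fromℚᵘ (U.mkℚᵘ a 0))
      (UP.≃-trans (ℚP.toℚᵘ-homo‿- (ℤtoℚ b)) (UP.-‿cong (ℚP.toℚᵘ-fromℚᵘ (U.mkℚᵘ b 0)))))))))
  where
  open ℤSolver.+-*-Solver using ()
    renaming (solve to ℤsolve; _:+_ to _⊕_; _:*_ to _⊗_; :-_ to ⊖_; _:=_ to _≐_; con to ℤcon)
  difference : U.mkℚᵘ (a ℤ.- b) 0 U.≃ (U.mkℚᵘ a 0 U.+ U.- U.mkℚᵘ b 0)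
  difference = U.*≡* (ℤsolve 2 (λ a b → (a ⊕ (⊖ b)) ⊗ ℤcon (ℤ.+ 1)
                                   ≐ (a ⊗ ℤcon (ℤ.+ 1) ⊕ (⊖ b) ⊗ ℤcon (ℤ.+ 1)) ⊗ ℤcon (ℤ.+ 1))
                        refl a b)

roots-sum : ∀ x j v p →
  numeratorRoot x j v + denominatorRoot j (v ℤ.- p)
    ≡ numeratorRoot x j (v ℤ.- p) + denominatorRoot j v
roots-sum x j v p rewrite ℤtoℚ-minus v p =
  solve 4 (λ x V J p → (x :+ con 1ℚ :+ V :- J) :+ (con 1ℚ :+ (V :- p) :- J)
                      := (x :+ con 1ℚ :+ (V :- p) :- J) :+ (con 1ℚ :+ V :- J))
    refl x (ℤtoℚ v) (ℕtoℚ j) (ℤtoℚ p)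

roots-product : ∀ x j v p →
  numeratorRoot x j v * denominatorRoot j (v ℤ.- p) + ℤtoℚ p * x
    ≡ numeratorRoot x j (v ℤ.- p) * denominatorRoot j v
roots-product x j v p rewrite ℤtoℚ-minus v p =
  solve 4 (λ x V J p → (x :+ con 1ℚ :+ V :- J) :* (con 1ℚ :+ (V :- p) :- J) :+ p :* x
                      := (x :+ con 1ℚ :+ (V :- p) :- J) :* (con 1ℚ :+ V :- J))
    refl x (ℤtoℚ v) (ℕtoℚ j) (ℤtoℚ p)

prodS-update : ∀ {l} x (ν : Vec ℤ l) (k : Fin l) (p : ℤ) →
  prodS x (updateAt ν k (λ z → z ℤ.- p))
    ≈S (λ n → prodS x ν n
              + (ℤtoℚ p * x)
                * shift2 (prodS x ν ⊛ invQuad (numeratorRoot x (suc (toℕ k)) (lookup ν k))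
                                              (denominatorRoot (suc (toℕ k)) (lookup ν k ℤ.- p))) n)
prodS-update x ν k p = mulQuad-inj α β (≈-trans cross (≈-sym expand))
  where
  j = suc (toℕ k)
  v = lookup ν k
  α = numeratorRoot x j v
  β = denominatorRoot j (v ℤ.- p)
  γ = numeratorRoot x j (v ℤ.- p)
  δ = denominatorRoot j v
  K = ℤtoℚ p * x
  P = prodS x ν

  cross : mulQuad α β (prodS x (updateAt ν k (λ z → z ℤ.- p))) ≈S mulQuad γ δ P
  cross = prodFrom-update x 1 ν k (λ z → z ℤ.- p) α β γ δ j (ℕP.+-comm 1 (toℕ k))
            (factorS-cross x j v (v ℤ.- p))

  cancel : mulQuad α β (shift2 (P ⊛ invQuad α β)) ≈S shift2 P
  cancel = ≈-trans (mulQuad-shift2 α β (P ⊛ invQuad α β))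
    (shift2-cong (≈-trans (mulQuad-⊛ʳ α β P (invQuad α β))
                 (≈-trans (⊛-congʳ P (mulQuad-invQuad α β)) (⊛-oneS P))))

  expand : mulQuad α β (λ n → P n + K * shift2 (P ⊛ invQuad α β) n) ≈S mulQuad γ δ P
  expand = ≈-trans (mulQuad-linear α β K P (shift2 (P ⊛ invQuad α β)))
    (≈-trans (λ n → cong (λ t → mulQuad α β P n + K * t) (cancel n))
             (mulQuad-perturb α β γ δ K P (roots-sum x j v p) (roots-product x j v p)))

tripleSum-invQuad : ∀ m (a : Series) A B →
  tripleSum m (λ r s t → a t * A ^ℚ r * B ^ℚ s) ≡ shift2 (a ⊛ invQuad A B) m
tripleSum-invQuad zero          a A B = refl
tripleSum-invQuad (suc zero)    a A B = refl
tripleSum-invQuad (suc (suc n)) a A B = Σ-cong n (λ t _ →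
  trans (Σ-cong (n ∸ t) (λ r _ →
          solve 3 (λ a x y → a :* x :* y := a :* (x :* y)) refl
            (a t) (A ^ℚ r) (B ^ℚ (n ∸ t ∸ r))))
        (Σ-scale (n ∸ t) (a t) (λ r → A ^ℚ r * B ^ℚ (n ∸ t ∸ r))))

c-series : ∀ {l} (ν : Vec ℤ l) q .{{_ : NonZero q}} →
  (λ m → c ν q m) ≈S (λ m → (- ((ℤ.+ 1) / q)) * prodS (ℕtoℚ q) ν m)
c-series ν q m =
  solve 2 (λ P u → :- (P :* u) := (:- u) :* P) refl (prodS (ℕtoℚ q) ν m) ((ℤ.+ 1) / q)

lemma1 : (l : ℕ) (λ′ : Vec ℕ l) → IsPartition λ′ →
    (i : ℕ) (k : Fin l) (p q : ℕ) → 1 ≤ i → 1 ≤ p → .{{_ : NonZero q}} →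
    c (minusAt λ′ k p) q i
      ≡ c (toℤs λ′) q i
        + ℕtoℚ p * ℕtoℚ q
          * tripleSum i (λ r s t →
              c (toℤs λ′) q t
              * ((ℕtoℚ (lookup λ′ k) - ℕtoℚ (suc (toℕ k)) + ℕtoℚ q + ℕtoℚ 1) ^ℚ r)
              * ((ℕtoℚ (lookup λ′ k) - ℕtoℚ (suc (toℕ k)) - ℕtoℚ p + ℕtoℚ 1) ^ℚ s))
lemma1 l λ′ _ i k p q _ _ = begin
    - (prodS x (minusAt λ′ k p) i * u)
  ≡⟨ cong (λ t → - (t * u)) (prodS-update x ν k (ℤ.+ p) i) ⟩
    - ((P i + K * shift2 (P ⊛ invQuad α β) i) * u)
  ≡⟨ solve 4 (λ P K Q u → :- ((P :+ K :* Q) :* u) := :- (P :* u) :+ K :* ((:- u) :* Q))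
       refl (P i) K (shift2 (P ⊛ invQuad α β) i) u ⟩
    c ν q i + K * ((- u) * shift2 (P ⊛ invQuad α β) i)
  ≡⟨ cong (λ t → c ν q i + K * t) (shift2-scale (- u) (P ⊛ invQuad α β) i) ⟩
    c ν q i + K * shift2 (λ m → (- u) * (P ⊛ invQuad α β) m) i
  ≡⟨ cong (λ t → c ν q i + K * t) (shift2-cong
       (≈-sym (≈-trans (⊛-congˡ (invQuad α β) (c-series ν q)) (⊛-scaleˡ (- u) P (invQuad α β)))) i) ⟩
    c ν q i + K * shift2 ((λ m → c ν q m) ⊛ invQuad α β) i
  ≡⟨ cong (λ t → c ν q i + K * t) (sym (tripleSum-invQuad i (λ m → c ν q m) α β)) ⟩
    c ν q i + K * tripleSum i (λ r s t → c ν q t * α ^ℚ r * β ^ℚ s)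
  ≡⟨ cong₂ (λ A B → c ν q i + K * tripleSum i (λ r s t → c ν q t * A ^ℚ r * B ^ℚ s))
       numeratorRoot≡ denominatorRoot≡ ⟩
    c ν q i + K * tripleSum i (λ r s t → c ν q t * Aₖ ^ℚ r * Bₖ ^ℚ s)
  ∎
  where
  open ≡-Reasoning
  x = ℕtoℚ q
  u = (ℤ.+ 1) / q
  ν = toℤs λ′
  P = prodS x ν
  K = ℕtoℚ p * x
  j = suc (toℕ k)
  α = numeratorRoot x j (lookup ν k)
  β = denominatorRoot j (lookup ν k ℤ.- ℤ.+ p)
  Aₖ Bₖ : ℚ
  Aₖ = ℕtoℚ (lookup λ′ k) - ℕtoℚ j + x + ℕtoℚ 1
  Bₖ = ℕtoℚ (lookup λ′ k) - ℕtoℚ j - ℕtoℚ p + ℕtoℚ 1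

  part≡ : ℤtoℚ (lookup ν k) ≡ ℕtoℚ (lookup λ′ k)
  part≡ = cong ℤtoℚ (lookup-map k ℤ.+_ λ′)

  numeratorRoot≡ : α ≡ Aₖ
  numeratorRoot≡ rewrite part≡ =
    solve 3 (λ L J x → x :+ con 1ℚ :+ L :- J := L :- J :+ x :+ con 1ℚ) refl
      (ℕtoℚ (lookup λ′ k)) (ℕtoℚ j) x

  denominatorRoot≡ : β ≡ Bₖ
  denominatorRoot≡ rewrite ℤtoℚ-minus (lookup ν k) (ℤ.+ p) | part≡ =
    solve 3 (λ L J p → con 1ℚ :+ (L :- p) :- J := L :- J :- p :+ con 1ℚ) refl
      (ℕtoℚ (lookup λ′ k)) (ℕtoℚ j) (ℕtoℚ p)
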